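{- Let $a,r$ be positive integers, let $\xi(a;r)$ denote the cycle $(a,a+1,\dots,a+r)$, and let $t_1,\dots,t_r$ be integers with $2\le t_1\le\dots\le t_r$. Then $\xi(a;r)$ can be expressed as a product of $r$ transpositions $$\xi(a;r)=(s_1,t_1)(s_2,t_2)\cdots(s_r,t_r),\qquad s_i<t_i\ (1\le i\le r),$$ (with $s_i$ positive integers) if and only if $(t_1,\dots,t_r)\in\mathfrak E(a;r)$. Furthermore, for each $(t_1,\dots,t_r)\in\mathfrak E(a;r)$ this expression is unique, i.e. the $s_i$ are uniquely determined.
   Context: $\mathfrak E(a;r)$ is the set of integer sequences $(i_1,\dots,i_r)$ with $i_1\le\dots\le i_r$, $i_p\ge a+p$ for $1\le p\le r-1$, and $i_r=a+r$. Permutations are of the positive integers, multiplied by composition with the rightmost factor applied first. -}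

module Defs where

open import Data.Nat using (ℕ; zero; suc; _+_; _≤_; _<_; _≟_; _<?_; _≤?_)
open import Data.Fin using (Fin; toℕ) renaming (zero to fzero; suc to fsuc; _≤_ to _≤ᶠ_)
open import Data.Product using (_×_; Σ-syntax)
open import Relation.Nullary using (yes; no)
open import Relation.Binary.PropositionalEquality using (_≡_)
open import Function using (id; _∘_)

-- Permutations of the positive integers are represented as functions ℕ → ℕ
-- (0 is fixed by every permutation considered here and is ignored in comparisons).

transp : ℕ → ℕ → ℕ → ℕ
transp s t x with x ≟ s
... | yes _ = t
... | no _ with x ≟ t
...   | yes _ = s
...   | no _ = x

ξ : ℕ → ℕ → ℕ → ℕ
ξ a r x with a ≤? x
... | no _ = x
... | yes _ with x <? a + r
...   | yes _ = suc x
...   | no _ with x ≟ a + r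
...     | yes _ = a
...     | no _ = x

-- The product (s₁,t₁)(s₂,t₂)⋯(s_r,t_r), rightmost factor applied first.
prodTransp : (r : ℕ) → (Fin r → ℕ) → (Fin r → ℕ) → ℕ → ℕ
prodTransp zero    s t = id
prodTransp (suc r) s t = transp (s fzero) (t fzero) ∘ prodTransp r (s ∘ fsuc) (t ∘ fsuc)

_≈ₚ_ : (ℕ → ℕ) → (ℕ → ℕ) → Set
f ≈ₚ g = ∀ x → 1 ≤ x → f x ≡ g x

-- Index i : Fin r stands for position p = toℕ i + 1.
-- 𝔈(a;r): i₁ ≤ ⋯ ≤ i_r, i_p ≥ a+p for 1 ≤ p ≤ r-1, i_r = a+r.
InE : (a r : ℕ) → (Fin r → ℕ) → Set
InE a r t =
  (∀ i j → i ≤ᶠ j → t i ≤ t j)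
  × (∀ i → suc (toℕ i) < r → a + suc (toℕ i) ≤ t i)
  × (∀ i → suc (toℕ i) ≡ r → t i ≡ a + r)

IsExpression : (a r : ℕ) → (Fin r → ℕ) → (Fin r → ℕ) → Set
IsExpression a r t s =
  (∀ i → 1 ≤ s i × s i < t i) × (ξ a r ≈ₚ prodTransp r s t)

Expressible : (a r : ℕ) → (Fin r → ℕ) → Set
Expressible a r t = Σ[ s ∈ (Fin r → ℕ) ] IsExpression a r t s

module Submission where

-- We prove this for the cycle on an arbitrary increasing chain c₀ < ⋯ < c_r of
-- positive integers; ξ(a;r) is the case c = a, a+1, …, a+r.  The key step is that
-- the first factor (s₁,t₁) of such a factorisation joins two consecutive points
-- s₁ < t₁ of the chain.  This is a counting argument: with T = t₁ (the least tᵢ)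
-- we attach to each permutation a potential (points below T that move, plus
-- points from T on that move up); the cycle has r ascents, hence potential ≥ r,
-- while every factor can raise the potential by at most one, and the first one
-- only if the rest of the product fixes s₁.  Deleting s₁ from the chain then
-- removes the factor (s₁,t₁), and induction on r shows: a factorisation exists
-- iff each tᵢ is a point of the chain with at least i points below it
-- ("admissible"), and the sᵢ are unique.  Finally, for c = a, …, a+r,
-- admissibility is exactly membership in 𝔈(a;r).

open import Defs
open import Data.Nat using (ℕ; zero; suc; _+_; _∸_; _≤_; _<_; z≤n; s≤s)
open import Data.Nat.Properties
open import Data.Fin using (Fin; toℕ; fromℕ) renaming (zero to fzero; suc to fsuc; _≤_ to _≤ᶠ_)
open import Data.Fin.Properties using (toℕ<n; toℕ-fromℕ; ≤fromℕ)
open import Data.List using (List; []; _∷_; _++_; length)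
open import Data.List.Relation.Unary.All as All using (All; []; _∷_)
open import Data.List.Relation.Unary.AllPairs as AllPairs using (AllPairs; []; _∷_)
open import Data.List.Relation.Unary.Any using (here; there)
open import Data.List.Relation.Unary.Unique.Propositional using (Unique)
open import Data.List.Membership.Propositional using (_∈_)
open import Data.List.Membership.Propositional.Properties using (∈-++⁺ʳ)
open import Data.Vec.Functional using () renaming (_∷_ to _∷ᵥ_)
open import Data.Product using (_×_; _,_; proj₁; proj₂; Σ-syntax)
open import Data.Empty using (⊥-elim)
open import Relation.Nullary using (Dec; yes; no; ¬_)
open import Relation.Nullary.Decidable using (¬?)
open import Relation.Binary using (tri<; tri≈; tri>)
open import Relation.Binary.PropositionalEquality
open import Function using (id; _∘_)
open import Function.Bundles using (_⇔_; mk⇔)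
open import Algebra.Properties.CommutativeSemigroup +-commutativeSemigroup using (interchange)

𝟙 : {P : Set} → Dec P → ℕ
𝟙 (yes _) = 1
𝟙 (no _)  = 0

𝟙-yes : {P : Set} (d : Dec P) → P → 𝟙 d ≡ 1
𝟙-yes (yes _) _ = refl
𝟙-yes (no ¬p) p = ⊥-elim (¬p p)

𝟙-no : {P : Set} (d : Dec P) → ¬ P → 𝟙 d ≡ 0
𝟙-no (yes p) ¬p = ⊥-elim (¬p p)
𝟙-no (no _)  _  = refl

𝟙≤1 : {P : Set} (d : Dec P) → 𝟙 d ≤ 1
𝟙≤1 (yes _) = ≤-refl
𝟙≤1 (no _)  = z≤n

Injective : (ℕ → ℕ) → Set
Injective f = ∀ {x y} → f x ≡ f y → x ≡ y

transp-left : ∀ s t → transp s t s ≡ t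
transp-left s t with s ≟ s
... | yes _ = refl
... | no s≢s = ⊥-elim (s≢s refl)

transp-right : ∀ s t → transp s t t ≡ s
transp-right s t with t ≟ s
... | yes t≡s = t≡s
... | no _ with t ≟ t
...   | yes _ = refl
...   | no t≢t = ⊥-elim (t≢t refl)

transp-other : ∀ s t {x} → x ≢ s → x ≢ t → transp s t x ≡ x
transp-other s t {x} x≢s x≢t with x ≟ s
... | yes x≡s = ⊥-elim (x≢s x≡s)
... | no _ with x ≟ t
...   | yes x≡t = ⊥-elim (x≢t x≡t)
...   | no _ = refl

data TranspView (s t x : ℕ) : Set where
  at-left  : x ≡ s → TranspView s t x
  at-right : x ≢ s → x ≡ t → TranspView s t x
  fixed    : x ≢ s → x ≢ t → TranspView s t x

transp-view : ∀ s t x → TranspView s t x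
transp-view s t x with x ≟ s | x ≟ t
... | yes x≡s | _       = at-left x≡s
... | no x≢s  | yes x≡t = at-right x≢s x≡t
... | no x≢s  | no x≢t  = fixed x≢s x≢t

transp-involutive : ∀ s t x → transp s t (transp s t x) ≡ x
transp-involutive s t x with transp-view s t x
... | at-left refl = trans (cong (transp s t) (transp-left s t)) (transp-right s t)
... | at-right _ refl = trans (cong (transp s t) (transp-right s t)) (transp-left s t)
... | fixed x≢s x≢t = trans (cong (transp s t) (transp-other s t x≢s x≢t)) (transp-other s t x≢s x≢t)

transp-injective : ∀ s t → Injective (transp s t)
transp-injective s t {x} {y} eq = begin
  x                             ≡⟨ sym (transp-involutive s t x) ⟩
  transp s t (transp s t x)     ≡⟨ cong (transp s t) eq ⟩
  transp s t (transp s t y)     ≡⟨ transp-involutive s t y ⟩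
  y                             ∎
  where open ≡-Reasoning

transp-relabel : ∀ π → Injective π → ∀ s t x → π (transp s t x) ≡ transp (π s) (π t) (π x)
transp-relabel π π-inj s t x with transp-view s t x
... | at-left refl = trans (cong π (transp-left s t)) (sym (transp-left (π s) (π t)))
... | at-right _ refl = trans (cong π (transp-right s t)) (sym (transp-right (π s) (π t)))
... | fixed x≢s x≢t = trans (cong π (transp-other s t x≢s x≢t))
                           (sym (transp-other (π s) (π t) (x≢s ∘ π-inj) (x≢t ∘ π-inj)))

transp-commute : ∀ {a b c d} → a ≢ c → a ≢ d → b ≢ c → b ≢ d →
                 ∀ x → transp a b (transp c d x) ≡ transp c d (transp a b x)
transp-commute {a} {b} {c} {d} a≢c a≢d b≢c b≢d x =
  trans (transp-relabel (transp a b) (transp-injective a b) c d x)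
        (cong₂ (λ c′ d′ → transp c′ d′ (transp a b x))
               (transp-other a b (a≢c ∘ sym) (b≢c ∘ sym))
               (transp-other a b (a≢d ∘ sym) (b≢d ∘ sym)))

transp-braid : ∀ {w u v} → w ≢ u → w ≢ v →
               ∀ x → transp w u (transp u v x) ≡ transp u v (transp w v x)
transp-braid {w} {u} {v} w≢u w≢v x = sym (
  trans (transp-relabel (transp u v) (transp-injective u v) w v x)
        (cong₂ (λ w′ v′ → transp w′ v′ (transp u v x))
               (transp-other u v w≢u w≢v) (transp-right u v)))

prodTransp-injective : ∀ r s t → Injective (prodTransp r s t)
prodTransp-injective zero    s t eq = eq
prodTransp-injective (suc r) s t eq =
  prodTransp-injective r (s ∘ fsuc) (t ∘ fsuc) (transp-injective (s fzero) (t fzero) eq)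

∑ : List ℕ → (ℕ → ℕ) → ℕ
∑ []      f = 0
∑ (x ∷ L) f = f x + ∑ L f

∑-mono : ∀ {f g} L → All (λ x → f x ≤ g x) L → ∑ L f ≤ ∑ L g
∑-mono []      []       = z≤n
∑-mono (x ∷ L) (p ∷ ps) = +-mono-≤ p (∑-mono L ps)

∑-cong : ∀ {f g} L → All (λ x → f x ≡ g x) L → ∑ L f ≡ ∑ L g
∑-cong []      []       = refl
∑-cong (x ∷ L) (p ∷ ps) = cong₂ _+_ p (∑-cong L ps)

∑-zero : ∀ {f} L → All (λ x → f x ≡ 0) L → ∑ L f ≡ 0
∑-zero []      []       = refl
∑-zero (x ∷ L) (p ∷ ps) = cong₂ _+_ p (∑-zero L ps)

∑-subadditive : ∀ {h f g} L → (∀ x → h x ≤ f x + g x) → ∑ L h ≤ ∑ L f + ∑ L g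
∑-subadditive []      _ = z≤n
∑-subadditive {h} {f} {g} (x ∷ L) h≤f+g =
  ≤-trans (+-mono-≤ (h≤f+g x) (∑-subadditive L h≤f+g))
          (≤-reflexive (interchange (f x) (g x) (∑ L f) (∑ L g)))

∑-remove : ∀ pre u rest f → ∑ (pre ++ u ∷ rest) f ≡ f u + ∑ (pre ++ rest) f
∑-remove []        u rest f = refl
∑-remove (w ∷ pre) u rest f = begin
  f w + ∑ (pre ++ u ∷ rest) f      ≡⟨ cong (f w +_) (∑-remove pre u rest f) ⟩
  f w + (f u + ∑ (pre ++ rest) f)  ≡⟨ sym (+-assoc (f w) (f u) _) ⟩
  (f w + f u) + ∑ (pre ++ rest) f  ≡⟨ cong (_+ ∑ (pre ++ rest) f) (+-comm (f w) (f u)) ⟩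
  (f u + f w) + ∑ (pre ++ rest) f  ≡⟨ +-assoc (f u) (f w) _ ⟩
  f u + (f w + ∑ (pre ++ rest) f)  ∎
  where open ≡-Reasoning

∑-preimage≤1 : ∀ {B} s D → Unique D → Injective B → ∑ D (λ x → 𝟙 (B x ≟ s)) ≤ 1
∑-preimage≤1 s []      _                 _     = z≤n
∑-preimage≤1 {B} s (y ∷ D) (y∉D ∷ D-unique) B-inj with B y ≟ s
... | yes By≡s = ≤-reflexive (cong suc (∑-zero D (All.map no-other-preimage y∉D)))
  where
  no-other-preimage : ∀ {x} → y ≢ x → 𝟙 (B x ≟ s) ≡ 0
  no-other-preimage y≢x = 𝟙-no (_ ≟ s) (λ Bx≡s → y≢x (B-inj (trans By≡s (sym Bx≡s))))
... | no _ = ∑-preimage≤1 s D D-unique B-inj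

All-remove : ∀ {P : ℕ → Set} pre {u rest} → All P (pre ++ u ∷ rest) → All P (pre ++ rest)
All-remove []        (_ ∷ ps) = ps
All-remove (w ∷ pre) (p ∷ ps) = p ∷ All-remove pre ps

All-at : ∀ {P : ℕ → Set} pre {u rest} → All P (pre ++ u ∷ rest) → P u
All-at pre ps = All.lookup ps (∈-++⁺ʳ pre (here refl))

All-at₂ : ∀ {P : ℕ → Set} pre {u v post} → All P (pre ++ u ∷ v ∷ post) → P u × P v
All-at₂ pre ps = All-at pre ps , All-at pre (All-remove pre ps)

AllPairs-remove : ∀ {R : ℕ → ℕ → Set} pre {u rest} → AllPairs R (pre ++ u ∷ rest) → AllPairs R (pre ++ rest)
AllPairs-remove []        (_ ∷ ps)  = ps
AllPairs-remove (w ∷ pre) (p ∷ ps) = All-remove pre p ∷ AllPairs-remove pre ps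

length-remove : ∀ pre {u : ℕ} {rest} → length (pre ++ u ∷ rest) ≡ suc (length (pre ++ rest))
length-remove []        = refl
length-remove (w ∷ pre) = cong suc (length-remove pre)

∈-insert : ∀ pre {u rest} {x : ℕ} → x ∈ pre ++ rest → x ∈ pre ++ u ∷ rest
∈-insert []        x∈ = there x∈
∈-insert (w ∷ pre) (here x≡w) = here x≡w
∈-insert (w ∷ pre) (there x∈) = there (∈-insert pre x∈)

∈-remove : ∀ pre {u rest} {x : ℕ} → x ∈ pre ++ u ∷ rest → x ≢ u → x ∈ pre ++ rest
∈-remove []        (here x≡u) x≢u = ⊥-elim (x≢u x≡u)
∈-remove []        (there x∈) _   = x∈
∈-remove (w ∷ pre) (here x≡w) _   = here x≡w
∈-remove (w ∷ pre) (there x∈) x≢u = there (∈-remove pre x∈ x≢u)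

Increasing : List ℕ → Set
Increasing = AllPairs _<_

Adjacent : ℕ → ℕ → List ℕ → Set
Adjacent u v c = Σ[ pre ∈ List ℕ ] Σ[ post ∈ List ℕ ] c ≡ pre ++ u ∷ v ∷ post

-- For c = c₀ < c₁ < ⋯ < cₙ this is the cycle (c₀,c₁,…,cₙ), written as the
-- product (c₀,c₁)(c₁,c₂)⋯(cₙ₋₁,cₙ).
cycle : List ℕ → ℕ → ℕ
cycle []          = id
cycle (u ∷ [])    = id
cycle (u ∷ v ∷ c) = transp u v ∘ cycle (v ∷ c)

cycle-fixes-smaller : ∀ c {x} → All (x <_) c → cycle c x ≡ x
cycle-fixes-smaller []          _ = refl
cycle-fixes-smaller (u ∷ [])    _ = refl
cycle-fixes-smaller (u ∷ v ∷ c) (x<u ∷ x<v ∷ x<c) =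
  trans (cong (transp u v) (cycle-fixes-smaller (v ∷ c) (x<v ∷ x<c)))
        (transp-other u v (<⇒≢ x<u) (<⇒≢ x<v))

cycle-injective : ∀ c → Injective (cycle c)
cycle-injective []          eq = eq
cycle-injective (u ∷ [])    eq = eq
cycle-injective (u ∷ v ∷ c) eq = cycle-injective (v ∷ c) (transp-injective u v eq)

cycle-remove : ∀ pre {u v post} → Increasing (pre ++ u ∷ v ∷ post) →
               ∀ x → cycle (pre ++ u ∷ v ∷ post) x ≡ transp u v (cycle (pre ++ v ∷ post) x)
cycle-remove []             _ x = refl
cycle-remove (w ∷ [])       {v = v} {post} ((w<u ∷ w<v ∷ _) ∷ _) x =
  transp-braid (<⇒≢ w<u) (<⇒≢ w<v) (cycle (v ∷ post) x)
cycle-remove (w ∷ w′ ∷ pre) {v = v} {post} (w<⋯ ∷ w′<⋯ ∷ inc) x =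
  let w<u  , w<v  = All-at₂ (w′ ∷ pre) w<⋯
      w′<u , w′<v = All-at₂ pre w′<⋯
  in trans (cong (transp w w′) (cycle-remove (w′ ∷ pre) (w′<⋯ ∷ inc) x))
           (transp-commute (<⇒≢ w<u) (<⇒≢ w<v) (<⇒≢ w′<u) (<⇒≢ w′<v) (cycle (w′ ∷ pre ++ v ∷ post) x))

-- On u ∷ v ∷ c, let z be the image of x under the shorter cycle: z = u forces
-- x = u, y = v; z = v would force y = u, i.e. x < u, so x would be fixed; in all
-- other cases (u,v) fixes z and the ascent lies on the shorter cycle.
cycle-ascent-adjacent : ∀ c {x y} → Increasing c → x < y → cycle c x ≡ y → Adjacent x y c
cycle-ascent-adjacent []          _ x<y refl = ⊥-elim (<-irrefl refl x<y)
cycle-ascent-adjacent (u ∷ [])    _ x<y refl = ⊥-elim (<-irrefl refl x<y)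
cycle-ascent-adjacent (u ∷ v ∷ c) {x} {y} (u<⋯ ∷ inc) x<y eq
  with transp-view u v (cycle (v ∷ c) x)
... | at-left z≡u = [] , c , cong₂ (λ x′ y′ → x′ ∷ y′ ∷ c) (sym x≡u) (sym y≡v)
  where
  x≡u : x ≡ u
  x≡u = cycle-injective (v ∷ c) (trans z≡u (sym (cycle-fixes-smaller (v ∷ c) u<⋯)))
  y≡v : y ≡ v
  y≡v = trans (sym eq) (trans (cong (transp u v) z≡u) (transp-left u v))
... | at-right _ z≡v = ⊥-elim (<-irrefl x≡v (<-trans x<u (All.head u<⋯)))
  where
  x<u : x < u
  x<u = subst (x <_) (trans (sym eq) (trans (cong (transp u v) z≡v) (transp-right u v))) x<y
  x≡v : x ≡ v
  x≡v = trans (sym (cycle-fixes-smaller (v ∷ c) (All.map (<-trans x<u) u<⋯))) z≡v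
... | fixed z≢u z≢v with cycle-ascent-adjacent (v ∷ c) inc x<y (trans (sym (transp-other u v z≢u z≢v)) eq)
...   | pre , post , c≡ = u ∷ pre , post , cong (u ∷_) c≡

ascents : List ℕ → (ℕ → ℕ) → ℕ
ascents c π = ∑ c (λ x → 𝟙 (x <? π x))

cycle-ascents : ∀ c → Increasing c → length c ∸ 1 ≤ ascents c (cycle c)
cycle-ascents []          _ = z≤n
cycle-ascents (u ∷ [])    _ = z≤n
cycle-ascents (u ∷ v ∷ c) (u<⋯ ∷ inc@(v<⋯ ∷ _)) = begin
  1 + length c                            ≡⟨ cong (_+ length c) (sym (𝟙-yes (u <? _) u<cycle-u)) ⟩
  u-ascent + length c                     ≤⟨ +-monoʳ-≤ u-ascent (cycle-ascents (v ∷ c) inc) ⟩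
  u-ascent + ascents (v ∷ c) (cycle (v ∷ c))
    ≤⟨ +-monoʳ-≤ u-ascent (∑-mono (v ∷ c) (All.map ascent-kept (≤-refl ∷ All.map <⇒≤ v<⋯))) ⟩
  ascents (u ∷ v ∷ c) (cycle (u ∷ v ∷ c)) ∎
  where
  open ≤-Reasoning
  u-ascent : ℕ
  u-ascent = 𝟙 (u <? cycle (u ∷ v ∷ c) u)
  u<cycle-u : u < cycle (u ∷ v ∷ c) u
  u<cycle-u = subst (u <_) (sym (trans (cong (transp u v) (cycle-fixes-smaller (v ∷ c) u<⋯)) (transp-left u v)))
                    (All.head u<⋯)
  -- an ascent x < y of the shorter cycle lies above u and v, so (u,v) keeps it
  ascent-kept : ∀ {x} → v ≤ x → 𝟙 (x <? cycle (v ∷ c) x) ≤ 𝟙 (x <? cycle (u ∷ v ∷ c) x)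
  ascent-kept {x} v≤x with x <? cycle (v ∷ c) x
  ... | no _ = z≤n
  ... | yes x<y = ≤-reflexive (sym (𝟙-yes (x <? _) (subst (x <_) (sym (transp-other u v (>⇒≢ u<y) (>⇒≢ v<y))) x<y)))
    where
    v<y : v < cycle (v ∷ c) x
    v<y = ≤-<-trans v≤x x<y
    u<y : u < cycle (v ∷ c) x
    u<y = <-trans (All.head u<⋯) v<y

weight : ℕ → ℕ → ℕ → ℕ
weight T x y with x <? T
... | yes _ = 𝟙 (¬? (y ≟ x))
... | no _  = 𝟙 (x <? y)

weight-low : ∀ {T x} y → x < T → weight T x y ≡ 𝟙 (¬? (y ≟ x))
weight-low {T} {x} y x<T with x <? T
... | yes _ = refl
... | no x≮T = ⊥-elim (x≮T x<T)

weight-high : ∀ {T x} y → ¬ x < T → weight T x y ≡ 𝟙 (x <? y)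
weight-high {T} {x} y x≮T with x <? T
... | yes x<T = ⊥-elim (x≮T x<T)
... | no _ = refl

weight≤1 : ∀ T x y → weight T x y ≤ 1
weight≤1 T x y with x <? T
... | yes _ = 𝟙≤1 (¬? (y ≟ x))
... | no _  = 𝟙≤1 (x <? y)

weight-fixed : ∀ T x → weight T x x ≡ 0
weight-fixed T x with x <? T
... | yes _ = 𝟙-no (¬? (x ≟ x)) (λ x≢x → x≢x refl)
... | no _  = 𝟙-no (x <? x) (<-irrefl refl)

ascent≤weight : ∀ T x y → 𝟙 (x <? y) ≤ weight T x y
ascent≤weight T x y with x <? T
... | no _ = ≤-refl
... | yes _ with x <? y
...   | no _ = z≤n
...   | yes x<y = ≤-reflexive (sym (𝟙-yes (¬? (y ≟ x)) (>⇒≢ x<y)))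

weight-lower : ∀ {T s t} x → s < t → T ≤ t → weight T x s ≤ weight T x t
weight-lower {T} {s} {t} x s<t T≤t with x <? T
... | yes x<T = ≤-trans (𝟙≤1 (¬? (s ≟ x))) (≤-reflexive (sym (𝟙-yes (¬? (t ≟ x)) (>⇒≢ (<-≤-trans x<T T≤t)))))
... | no _ with x <? s
...   | no _ = z≤n
...   | yes x<s = ≤-reflexive (sym (𝟙-yes (x <? t) (<-trans x<s s<t)))

weight-transp : ∀ {T s t} x y → s < t → T ≤ t → weight T x (transp s t y) ≤ weight T x y + 𝟙 (y ≟ s)
weight-transp {T} {s} {t} x y s<t T≤t with transp-view s t y
... | at-left refl = ≤-trans (weight≤1 T x _) (≤-trans (≤-reflexive (sym (𝟙-yes (y ≟ y) refl))) (m≤n+m _ _))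
... | at-right _ refl = ≤-trans (≤-reflexive (cong (weight T x) (transp-right s y)))
                                (≤-trans (weight-lower x s<t T≤t) (m≤m+n _ _))
... | fixed y≢s y≢t = ≤-trans (≤-reflexive (cong (weight T x) (transp-other s t y≢s y≢t))) (m≤m+n _ _)

weight-transp-threshold : ∀ {T s} x y → s < T → (y ≡ s → x ≢ s) → weight T x (transp s T y) ≤ weight T x y
weight-transp-threshold {T} {s} x y s<T y≡s⇒x≢s with transp-view s T y
... | at-left refl = ≤-trans (≤-reflexive (cong (weight T x) (transp-left y T))) (at-threshold (x <? T))
  where
  at-threshold : Dec (x < T) → weight T x T ≤ weight T x y
  at-threshold (yes x<T) = ≤-trans (weight≤1 T x T)
                                   (≤-reflexive (sym (trans (weight-low y x<T) (𝟙-yes (¬? (y ≟ x)) (y≡s⇒x≢s refl ∘ sym)))))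
  at-threshold (no x≮T) = ≤-trans (≤-reflexive (trans (weight-high T x≮T) (𝟙-no (x <? T) x≮T))) z≤n
... | at-right _ refl = ≤-trans (≤-reflexive (cong (weight y x) (transp-right s y))) (weight-lower x s<T ≤-refl)
... | fixed y≢s y≢T = ≤-reflexive (cong (weight T x) (transp-other s T y≢s y≢T))

potential : ℕ → List ℕ → (ℕ → ℕ) → ℕ
potential T D π = ∑ D (λ x → weight T x (π x))

potential-product : ∀ {T} k s t D → Unique D → (∀ i → s i < t i) → (∀ i → T ≤ t i) →
                    potential T D (prodTransp k s t) ≤ k
potential-product {T} zero s t D _ _ _ = ≤-reflexive (∑-zero D (All.universal (weight-fixed T) D))
potential-product {T} (suc k) s t D D-unique s<t T≤t = begin
  potential T D (transp (s fzero) (t fzero) ∘ B)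
    ≤⟨ ∑-subadditive D (λ x → weight-transp x (B x) (s<t fzero) (T≤t fzero)) ⟩
  potential T D B + ∑ D (λ x → 𝟙 (B x ≟ s fzero))
    ≤⟨ +-mono-≤ (potential-product k (s ∘ fsuc) (t ∘ fsuc) D D-unique (s<t ∘ fsuc) (T≤t ∘ fsuc))
                (∑-preimage≤1 (s fzero) D D-unique (prodTransp-injective k (s ∘ fsuc) (t ∘ fsuc))) ⟩
  k + 1 ≡⟨ +-comm k 1 ⟩
  suc k ∎
  where
  open ≤-Reasoning
  B : ℕ → ℕ
  B = prodTransp k (s ∘ fsuc) (t ∘ fsuc)

record Chain (n : ℕ) (c : List ℕ) : Set where
  constructor chain
  field
    increasing : Increasing c
    positive   : All (1 ≤_) c
    size       : length c ≡ n
open Chain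

chain-remove : ∀ pre {u rest n} → Chain (suc n) (pre ++ u ∷ rest) → Chain n (pre ++ rest)
chain-remove pre (chain inc pos len) =
  chain (AllPairs-remove pre inc) (All-remove pre pos) (suc-injective (trans (sym (length-remove pre)) len))

Monotone : (r : ℕ) → (Fin r → ℕ) → Set
Monotone r t = ∀ i j → i ≤ᶠ j → t i ≤ t j

monotone-tail : ∀ {k t} → Monotone (suc k) t → Monotone k (t ∘ fsuc)
monotone-tail mono i j i≤j = mono (fsuc i) (fsuc j) (s≤s i≤j)

Factorisation : List ℕ → (r : ℕ) → (s t : Fin r → ℕ) → Set
Factorisation c r s t = (∀ i → 1 ≤ s i × s i < t i) × (cycle c ≈ₚ prodTransp r s t)

-- Writing the factorisation as (s₀,t₀) ∘ B with t₀ the least tᵢ, the counting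
-- argument forces B to fix s₀: otherwise the potential of the cycle at threshold t₀
-- would be at most k, while it has k+1 ascents.
first-factor-fixed : ∀ {k c} s t → Chain (suc (suc k)) c → Monotone (suc k) t → Factorisation c (suc k) s t →
                     prodTransp k (s ∘ fsuc) (t ∘ fsuc) (s fzero) ≡ s fzero
first-factor-fixed {k} {c} s t ch mono (bounds , c≈P)
  with prodTransp k (s ∘ fsuc) (t ∘ fsuc) (s fzero) ≟ s fzero
... | yes s₀-fixed = s₀-fixed
... | no moved = ⊥-elim (1+n≰n (begin
  suc k                                  ≡⟨ cong (_∸ 1) (sym (size ch)) ⟩
  length c ∸ 1                           ≤⟨ cycle-ascents c (increasing ch) ⟩
  ascents c (cycle c)                    ≤⟨ ∑-mono c (All.universal (λ x → ascent≤weight T x (cycle c x)) c) ⟩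
  potential T c (cycle c)                ≡⟨ ∑-cong c (All.map (λ {x} 1≤x → cong (weight T x) (c≈P x 1≤x)) (positive ch)) ⟩
  potential T c (transp (s fzero) T ∘ B) ≤⟨ ∑-mono c (All.universal (λ x → weight-transp-threshold x (B x) (proj₂ (bounds fzero)) (only-at x)) c) ⟩
  potential T c B                        ≤⟨ potential-product k (s ∘ fsuc) (t ∘ fsuc) c (AllPairs.map <⇒≢ (increasing ch))
                                                              (proj₂ ∘ bounds ∘ fsuc) (λ i → mono fzero (fsuc i) z≤n) ⟩
  k                                      ∎))
  where
  open ≤-Reasoning
  B : ℕ → ℕ
  B = prodTransp k (s ∘ fsuc) (t ∘ fsuc)
  T : ℕ
  T = t fzero
  only-at : ∀ x → B x ≡ s fzero → x ≢ s fzero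
  only-at x Bx≡s₀ refl = moved Bx≡s₀

cycle-at-first-factor : ∀ {k c} s t → Chain (suc (suc k)) c → Monotone (suc k) t → Factorisation c (suc k) s t →
                        cycle c (s fzero) ≡ t fzero
cycle-at-first-factor {k} {c} s t ch mono fac@(bounds , c≈P) = begin
  cycle c (s fzero)                                            ≡⟨ c≈P (s fzero) (proj₁ (bounds fzero)) ⟩
  transp (s fzero) (t fzero) (prodTransp k (s ∘ fsuc) (t ∘ fsuc) (s fzero)) ≡⟨ cong (transp (s fzero) (t fzero)) (first-factor-fixed s t ch mono fac) ⟩
  transp (s fzero) (t fzero) (s fzero)                         ≡⟨ transp-left (s fzero) (t fzero) ⟩
  t fzero                                                      ∎
  where open ≡-Reasoning

AllPairs-at : ∀ {R : ℕ → ℕ → Set} pre {u rest} → AllPairs R (pre ++ u ∷ rest) → All (R u) rest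
AllPairs-at []        (u<rest ∷ _) = u<rest
AllPairs-at (w ∷ pre) (_ ∷ ps)     = AllPairs-at pre ps

increasing-adjacent : ∀ pre {u v post} → Increasing (pre ++ u ∷ v ∷ post) → u < v
increasing-adjacent pre inc = All.head (AllPairs-at pre inc)

factorisation-peel : ∀ pre {u v post k} s t → Increasing (pre ++ u ∷ v ∷ post) → s fzero ≡ u → t fzero ≡ v →
                     Factorisation (pre ++ u ∷ v ∷ post) (suc k) s t →
                     Factorisation (pre ++ v ∷ post) k (s ∘ fsuc) (t ∘ fsuc)
factorisation-peel pre {u} {v} {post} {k} s t inc refl refl (bounds , c≈P) = bounds ∘ fsuc , c′≈B
  where
  c′≈B : cycle (pre ++ v ∷ post) ≈ₚ prodTransp k (s ∘ fsuc) (t ∘ fsuc)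
  c′≈B x 1≤x = begin
    cycle (pre ++ v ∷ post) x                          ≡⟨ sym (transp-involutive u v _) ⟩
    transp u v (transp u v (cycle (pre ++ v ∷ post) x)) ≡⟨ cong (transp u v) (sym (cycle-remove pre inc x)) ⟩
    transp u v (cycle (pre ++ u ∷ v ∷ post) x)          ≡⟨ cong (transp u v) (c≈P x 1≤x) ⟩
    transp u v (transp u v (prodTransp k (s ∘ fsuc) (t ∘ fsuc) x)) ≡⟨ transp-involutive u v _ ⟩
    prodTransp k (s ∘ fsuc) (t ∘ fsuc) x                ∎
    where open ≡-Reasoning

factorisation-extend : ∀ pre {u post k} s t → Increasing (pre ++ u ∷ t fzero ∷ post) → 1 ≤ u →
                       Factorisation (pre ++ t fzero ∷ post) k s (t ∘ fsuc) →
                       Factorisation (pre ++ u ∷ t fzero ∷ post) (suc k) (u ∷ᵥ s) t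
factorisation-extend pre {u} s t inc 1≤u (bounds , c≈B) = bounds′ , λ x 1≤x →
  trans (cycle-remove pre inc x) (cong (transp u (t fzero)) (c≈B x 1≤x))
  where
  bounds′ : ∀ i → 1 ≤ (u ∷ᵥ s) i × (u ∷ᵥ s) i < t i
  bounds′ fzero    = 1≤u , increasing-adjacent pre inc
  bounds′ (fsuc j) = bounds j

below : List ℕ → ℕ → ℕ
below c y = ∑ c (λ z → 𝟙 (z <? y))

below-remove : ∀ pre {u rest y} → u < y → below (pre ++ u ∷ rest) y ≡ suc (below (pre ++ rest) y)
below-remove pre {u} {rest} {y} u<y =
  trans (∑-remove pre u rest (λ z → 𝟙 (z <? y))) (cong (_+ below (pre ++ rest) y) (𝟙-yes (u <? y) u<y))

below-least : ∀ {y} c → All (y ≤_) c → below c y ≡ 0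
below-least c y≤c = ∑-zero c (All.map (λ y≤z → 𝟙-no (_ <? _) (≤⇒≯ y≤z)) y≤c)

Admissible : List ℕ → (r : ℕ) → (Fin r → ℕ) → Set
Admissible c r t = ∀ i → t i ∈ c × suc (toℕ i) ≤ below c (t i)

admissible-extend : ∀ pre {u post k} t → u < t fzero → Monotone (suc k) t →
                    Admissible (pre ++ t fzero ∷ post) k (t ∘ fsuc) → Admissible (pre ++ u ∷ t fzero ∷ post) (suc k) t
admissible-extend pre {u} t u<t₀ mono adm fzero =
  ∈-++⁺ʳ pre (there (here refl)) , ≤-trans (s≤s z≤n) (≤-reflexive (sym (below-remove pre u<t₀)))
admissible-extend pre {u} t u<t₀ mono adm (fsuc j) =
  ∈-insert pre (proj₁ (adm j)) ,
  ≤-trans (s≤s (proj₂ (adm j))) (≤-reflexive (sym (below-remove pre (<-≤-trans u<t₀ (mono fzero (fsuc j) z≤n)))))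

admissible-shrink : ∀ pre {u post k} t → u < t fzero → Monotone (suc k) t →
                    Admissible (pre ++ u ∷ t fzero ∷ post) (suc k) t → Admissible (pre ++ t fzero ∷ post) k (t ∘ fsuc)
admissible-shrink pre {u} t u<t₀ mono adm j =
  ∈-remove pre (proj₁ (adm (fsuc j))) (>⇒≢ u<tⱼ) ,
  ≤-pred (≤-trans (proj₂ (adm (fsuc j))) (≤-reflexive (below-remove pre u<tⱼ)))
  where
  u<tⱼ : u < t (fsuc j)
  u<tⱼ = <-≤-trans u<t₀ (mono fzero (fsuc j) z≤n)

predecessor : ∀ c {y} → Increasing c → y ∈ c → 1 ≤ below c y → Σ[ u ∈ ℕ ] Adjacent u y c
predecessor (y ∷ c)         (y<c ∷ _)        (here refl) 1≤below =
  ⊥-elim (1+n≰n (≤-trans 1≤below (≤-reflexive (below-least (y ∷ c) (≤-refl ∷ All.map <⇒≤ y<c)))))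
predecessor (w ∷ y ∷ c)     _                (there (here refl)) _ = w , [] , c , refl
predecessor (w ∷ z ∷ c) {y} (_ ∷ inc@(z<c ∷ _)) (there y∈z∷c@(there y∈c)) _
  with predecessor (z ∷ c) inc y∈z∷c (≤-trans (≤-reflexive (sym (𝟙-yes (z <? y) (All.lookup z<c y∈c)))) (m≤m+n _ _))
... | u , pre , post , eq = u , w ∷ pre , post , cong (w ∷_) eq

factorisation⇒admissible : ∀ r {c} s t → Chain (suc r) c → Monotone r t → Factorisation c r s t → Admissible c r t
factorisation⇒admissible zero    s t ch mono fac ()
factorisation⇒admissible (suc k) {c} s t ch mono fac@(bounds , _)
  with cycle-ascent-adjacent c (increasing ch) (proj₂ (bounds fzero)) (cycle-at-first-factor s t ch mono fac)
... | pre , post , refl =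
  admissible-extend pre t (proj₂ (bounds fzero)) mono
    (factorisation⇒admissible k (s ∘ fsuc) (t ∘ fsuc) (chain-remove pre ch) (monotone-tail mono)
      (factorisation-peel pre s t (increasing ch) refl refl fac))

factorisation-unique : ∀ r {c} s s′ t → Chain (suc r) c → Monotone r t →
                       Factorisation c r s t → Factorisation c r s′ t → ∀ i → s i ≡ s′ i
factorisation-unique zero    s s′ t ch mono fac fac′ ()
factorisation-unique (suc k) {c} s s′ t ch mono fac@(bounds , _) fac′
  with cycle-ascent-adjacent c (increasing ch) (proj₂ (bounds fzero)) (cycle-at-first-factor s t ch mono fac)
... | pre , post , refl = same
  where
  same-first : s fzero ≡ s′ fzero
  same-first = cycle-injective c (trans (cycle-at-first-factor s t ch mono fac)
                                        (sym (cycle-at-first-factor s′ t ch mono fac′)))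
  same : ∀ i → s i ≡ s′ i
  same fzero    = same-first
  same (fsuc j) = factorisation-unique k (s ∘ fsuc) (s′ ∘ fsuc) (t ∘ fsuc) (chain-remove pre ch) (monotone-tail mono)
                    (factorisation-peel pre s t (increasing ch) refl refl fac)
                    (factorisation-peel pre s′ t (increasing ch) (sym same-first) refl fac′) j

cycle-of-point : ∀ c → length c ≡ 1 → ∀ x → cycle c x ≡ x
cycle-of-point (u ∷ []) refl x = refl

-- Sufficiency: admissible second entries admit a factorisation, built by
-- repeatedly pairing the least tᵢ with its predecessor on the cycle.
admissible⇒factorisation : ∀ r {c} t → Chain (suc r) c → Monotone r t → Admissible c r t →
                           Σ[ s ∈ (Fin r → ℕ) ] Factorisation c r s t
admissible⇒factorisation zero {c} t ch mono adm = (λ ()) , (λ ()) , λ x _ → cycle-of-point c (size ch) x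
admissible⇒factorisation (suc k) {c} t ch mono adm
  with predecessor c (increasing ch) (proj₁ (adm fzero)) (proj₂ (adm fzero))
... | u , pre , post , refl
  with admissible⇒factorisation k (t ∘ fsuc) (chain-remove pre ch) (monotone-tail mono)
         (admissible-shrink pre t (increasing-adjacent pre (increasing ch)) mono adm)
...   | s , fac = u ∷ᵥ s , factorisation-extend pre s t (increasing ch) (All-at pre (positive ch)) fac

range : ℕ → ℕ → List ℕ
range a zero    = []
range a (suc n) = a ∷ range (suc a) n

range-above : ∀ n {a b} → b ≤ a → All (b ≤_) (range a n)
range-above zero    _   = []
range-above (suc n) b≤a = b≤a ∷ range-above n (m≤n⇒m≤1+n b≤a)

range-increasing : ∀ n a → Increasing (range a n)
range-increasing zero    a = []
range-increasing (suc n) a = range-above n ≤-refl ∷ range-increasing n (suc a)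

range-length : ∀ n a → length (range a n) ≡ n
range-length zero    a = refl
range-length (suc n) a = cong suc (range-length n (suc a))

range-chain : ∀ n {a} → 1 ≤ a → Chain n (range a n)
range-chain n {a} 1≤a = chain (range-increasing n a) (range-above n 1≤a) (range-length n a)

∈-range⁻ : ∀ n {a y} → y ∈ range a n → a ≤ y × y < a + n
∈-range⁻ (suc n) {a} (here refl) = ≤-refl , m<m+n a (s≤s z≤n)
∈-range⁻ (suc n) {a} {y} (there y∈) with ∈-range⁻ n y∈
... | a<y , y<1+a+n = <⇒≤ a<y , subst (y <_) (sym (+-suc a n)) y<1+a+n

∈-range⁺ : ∀ n {a y} → a ≤ y → y < a + n → y ∈ range a n
∈-range⁺ zero    {a} a≤y y<a+0 = ⊥-elim (<-irrefl refl (≤-<-trans a≤y (subst (_ <_) (+-identityʳ a) y<a+0)))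
∈-range⁺ (suc n) {a} {y} a≤y y<a+1+n with a ≟ y
... | yes refl = here refl
... | no a≢y   = there (∈-range⁺ n (≤∧≢⇒< a≤y a≢y) (subst (y <_) (+-suc a n) y<a+1+n))

below-range-≥ : ∀ n {a y} m → m ≤ n → a + m ≤ y → m ≤ below (range a n) y
below-range-≥ n       zero    _         _ = z≤n
below-range-≥ (suc n) {a} {y} (suc m) (s≤s m≤n) a+1+m≤y =
  ≤-trans (s≤s (below-range-≥ n m m≤n (subst (_≤ y) (+-suc a m) a+1+m≤y)))
          (≤-reflexive (sym (cong (_+ below (range (suc a) n) y) (𝟙-yes (a <? y) a<y))))
  where
  a<y : a < y
  a<y = <-≤-trans (m<m+n a (s≤s z≤n)) a+1+m≤y

below-range-≤ : ∀ n {a y} → a ≤ y → a + below (range a n) y ≤ y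
below-range-≤ zero    {a} {y} a≤y = subst (_≤ y) (sym (+-identityʳ a)) a≤y
below-range-≤ (suc n) {a} {y} a≤y with a <? y
... | yes a<y = subst (_≤ y) (sym (+-suc a _)) (below-range-≤ n a<y)
... | no a≮y  = ≤-trans (≤-reflexive (trans (cong (a +_) nothing-below) (+-identityʳ a))) a≤y
  where
  nothing-below : below (range (suc a) n) y ≡ 0
  nothing-below = below-least (range (suc a) n) (range-above n (m≤n⇒m≤1+n (≮⇒≥ a≮y)))

ξ-below : ∀ a r {x} → x < a → ξ a r x ≡ x
ξ-below a r {x} x<a with a ≤? x
... | yes a≤x = ⊥-elim (<-irrefl refl (<-≤-trans x<a a≤x))
... | no _    = refl

ξ-inside : ∀ a r {x} → a ≤ x → x < a + r → ξ a r x ≡ suc x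
ξ-inside a r {x} a≤x x<a+r with a ≤? x
... | no a≰x = ⊥-elim (a≰x a≤x)
... | yes _ with x <? a + r
...   | yes _    = refl
...   | no x≮a+r = ⊥-elim (x≮a+r x<a+r)

ξ-top : ∀ a r → ξ a r (a + r) ≡ a
ξ-top a r with a ≤? a + r
... | no a≰a+r = ⊥-elim (a≰a+r (m≤m+n a r))
... | yes _ with a + r <? a + r
...   | yes a+r<a+r = ⊥-elim (<-irrefl refl a+r<a+r)
...   | no _ with a + r ≟ a + r
...     | yes _ = refl
...     | no a+r≢a+r = ⊥-elim (a+r≢a+r refl)

ξ-above : ∀ a r {x} → a + r < x → ξ a r x ≡ x
ξ-above a r {x} a+r<x with a ≤? x
... | no _ = refl
... | yes _ with x <? a + r
...   | yes x<a+r = ⊥-elim (<-asym x<a+r a+r<x)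
...   | no _ with x ≟ a + r
...     | yes x≡a+r = ⊥-elim (<-irrefl (sym x≡a+r) a+r<x)
...     | no _ = refl

ξ-zero : ∀ a x → ξ a 0 x ≡ x
ξ-zero a x with <-cmp x a
... | tri< x<a _ _ = ξ-below a 0 x<a
... | tri≈ _ refl _ = trans (cong (ξ x 0) (sym (+-identityʳ x))) (ξ-top x 0)
... | tri> _ _ a<x = ξ-above a 0 (subst (_< x) (sym (+-identityʳ a)) a<x)

ξ-step : ∀ a r x → ξ a (suc r) x ≡ transp a (suc a) (ξ (suc a) r x)
ξ-step a r x with <-cmp x a
... | tri< x<a _ _ = begin
  ξ a (suc r) x                     ≡⟨ ξ-below a (suc r) x<a ⟩
  x                                 ≡⟨ sym (transp-other a (suc a) (<⇒≢ x<a) (<⇒≢ (m<n⇒m<1+n x<a))) ⟩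
  transp a (suc a) x                ≡⟨ cong (transp a (suc a)) (sym (ξ-below (suc a) r (m<n⇒m<1+n x<a))) ⟩
  transp a (suc a) (ξ (suc a) r x)  ∎
  where open ≡-Reasoning
... | tri≈ _ refl _ = begin
  ξ x (suc r) x                     ≡⟨ ξ-inside x (suc r) ≤-refl (m<m+n x (s≤s z≤n)) ⟩
  suc x                             ≡⟨ sym (transp-left x (suc x)) ⟩
  transp x (suc x) x                ≡⟨ cong (transp x (suc x)) (sym (ξ-below (suc x) r (n<1+n x))) ⟩
  transp x (suc x) (ξ (suc x) r x)  ∎
  where open ≡-Reasoning
... | tri> _ _ a<x with <-cmp x (suc a + r)
...   | tri< x<1+a+r _ _ = begin
  ξ a (suc r) x                     ≡⟨ ξ-inside a (suc r) (<⇒≤ a<x) (subst (x <_) (sym (+-suc a r)) x<1+a+r) ⟩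
  suc x                             ≡⟨ sym (transp-other a (suc a) (>⇒≢ (m<n⇒m<1+n a<x)) (>⇒≢ (s≤s a<x))) ⟩
  transp a (suc a) (suc x)          ≡⟨ cong (transp a (suc a)) (sym (ξ-inside (suc a) r a<x x<1+a+r)) ⟩
  transp a (suc a) (ξ (suc a) r x)  ∎
  where open ≡-Reasoning
...   | tri≈ _ refl _ = begin
  ξ a (suc r) (suc a + r)           ≡⟨ cong (ξ a (suc r)) (sym (+-suc a r)) ⟩
  ξ a (suc r) (a + suc r)           ≡⟨ ξ-top a (suc r) ⟩
  a                                 ≡⟨ sym (transp-right a (suc a)) ⟩
  transp a (suc a) (suc a)          ≡⟨ cong (transp a (suc a)) (sym (ξ-top (suc a) r)) ⟩
  transp a (suc a) (ξ (suc a) r (suc a + r)) ∎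
  where open ≡-Reasoning
...   | tri> _ _ 1+a+r<x = begin
  ξ a (suc r) x                     ≡⟨ ξ-above a (suc r) (subst (_< x) (sym (+-suc a r)) 1+a+r<x) ⟩
  x                                 ≡⟨ sym (transp-other a (suc a) (>⇒≢ a<x) (>⇒≢ (≤-<-trans (m≤m+n (suc a) r) 1+a+r<x))) ⟩
  transp a (suc a) x                ≡⟨ cong (transp a (suc a)) (sym (ξ-above (suc a) r 1+a+r<x)) ⟩
  transp a (suc a) (ξ (suc a) r x)  ∎
  where open ≡-Reasoning

ξ-cycle : ∀ r a x → ξ a r x ≡ cycle (range a (suc r)) x
ξ-cycle zero    a x = ξ-zero a x
ξ-cycle (suc r) a x = trans (ξ-step a r x) (cong (transp a (suc a)) (ξ-cycle r (suc a) x))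

admissible⇒InE : ∀ a r t → Monotone r t → Admissible (range a (suc r)) r t → InE a r t
admissible⇒InE a r t mono adm = mono , (λ i _ → lower i) , last
  where
  lower : ∀ i → a + suc (toℕ i) ≤ t i
  lower i = ≤-trans (+-monoʳ-≤ a (proj₂ (adm i)))
                    (below-range-≤ (suc r) (proj₁ (∈-range⁻ (suc r) (proj₁ (adm i)))))
  upper : ∀ i → t i ≤ a + r
  upper i = ≤-pred (subst (t i <_) (+-suc a r) (proj₂ (∈-range⁻ (suc r) (proj₁ (adm i)))))
  last : ∀ i → suc (toℕ i) ≡ r → t i ≡ a + r
  last i i+1≡r = ≤-antisym (upper i) (subst (λ m → a + m ≤ t i) i+1≡r (lower i))

InE⇒admissible : ∀ a r t → InE a r t → Admissible (range a (suc r)) r t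
InE⇒admissible a zero    t _ ()
InE⇒admissible a (suc r) t (mono , early , last) i =
  ∈-range⁺ (suc (suc r)) (≤-trans (m≤m+n a _) lower) (subst (t i <_) (sym (+-suc a (suc r))) (s≤s upper)) ,
  below-range-≥ (suc (suc r)) (suc (toℕ i)) (m≤n⇒m≤1+n (toℕ<n i)) lower
  where
  upper : t i ≤ a + suc r
  upper = subst (t i ≤_) (last (fromℕ r) (cong suc (toℕ-fromℕ r))) (mono i (fromℕ r) (≤fromℕ i))
  lower : a + suc (toℕ i) ≤ t i
  lower with suc (toℕ i) <? suc r
  ... | yes i+1<r = early i i+1<r
  ... | no i+1≮r  = subst (λ m → a + m ≤ t i) (sym i+1≡r) (≤-reflexive (sym (last i i+1≡r)))
    where
    i+1≡r : suc (toℕ i) ≡ suc r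
    i+1≡r = ≤-antisym (toℕ<n i) (≮⇒≥ i+1≮r)

-- Expressions of ξ(a;r) are the factorisations of the cycle on a, …, a+r, so the
-- theorem is the general characterisation and uniqueness specialised to this chain.
proposition5p18 : (a r : ℕ) → 1 ≤ a → 1 ≤ r → (t : Fin r → ℕ)
    → (∀ i → 2 ≤ t i) → (∀ i j → i ≤ᶠ j → t i ≤ t j)
    → (Expressible a r t ⇔ InE a r t)
      × (InE a r t → (s s′ : Fin r → ℕ) → IsExpression a r t s → IsExpression a r t s′ → ∀ i → s i ≡ s′ i)
proposition5p18 a r 1≤a _ t _ mono = mk⇔ necessity sufficiency , uniqueness
  where
  c : List ℕ
  c = range a (suc r)
  ch : Chain (suc r) c
  ch = range-chain (suc r) 1≤a
  as-factorisation : ∀ {s} → IsExpression a r t s → Factorisation c r s t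
  as-factorisation (bounds , ξ≈P) = bounds , λ x 1≤x → trans (sym (ξ-cycle r a x)) (ξ≈P x 1≤x)
  as-expression : ∀ {s} → Factorisation c r s t → IsExpression a r t s
  as-expression (bounds , c≈P) = bounds , λ x 1≤x → trans (ξ-cycle r a x) (c≈P x 1≤x)
  necessity : Expressible a r t → InE a r t
  necessity (s , expr) = admissible⇒InE a r t mono (factorisation⇒admissible r s t ch mono (as-factorisation expr))
  sufficiency : InE a r t → Expressible a r t
  sufficiency e with admissible⇒factorisation r t ch mono (InE⇒admissible a r t e)
  ... | s , fac = s , as-expression fac
  uniqueness : InE a r t → (s s′ : Fin r → ℕ) → IsExpression a r t s → IsExpression a r t s′ → ∀ i → s i ≡ s′ i
  uniqueness _ s s′ expr expr′ = factorisation-unique r s s′ t ch mono (as-factorisation expr) (as-factorisation expr′)
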